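{- For every $k\ge1$ and every vector $\vec v_0$ of naturals indexed by the counters of $\mathcal B_k$ such that $\vec v_0(d_i)=\vec v_0(d'_i)=0$ for all $i<k$, the BVASS $\mathcal B_k$ has a $(q^{\mathrm{init}}_k,\vec v_0)$-rooted $\{q^{\mathrm{leaf}}\}$-leaf-covering deduction tree if and only if $\vec v_0(d_k)\ge\mathrm{tower}(k)$.
   Context: A BVASS consists of a finite state set, a finite set of counters (coordinates), finite unary rules $q\xrightarrow{\vec u}q_1$ with $\vec u$ an integer vector over the counters, and split rules $q\to q_1+q_2$. Deduction trees are finite trees labelled by pairs $(q,\vec v)$ with $\vec v$ a vector of naturals over the counters, where each internal node with its children matches: (unary) $(q,\vec v)$ with single child $(q_1,\vec v+\vec u)$ for a unary rule $q\xrightarrow{\vec u}q_1$ with $\vec v+\vec u$ nonnegative; (split) $(q,\vec v_1+\vec v_2)$ with children $(q_1,\vec v_1),(q_2,\vec v_2)$ for a split rule $q\to q_1+q_2$. A deduction tree is $(q,\vec v_0)$-rooted if its root is labelled $(q,\vec v_0)$ and $\{q^{\mathrm{leaf}}\}$-leaf-covering if every leaf has state $q^{\mathrm{leaf}}$ (any vector). $\mathrm{tower}(0)=1$, $\mathrm{tower}(n+1)=2^{\mathrm{tower}(n)}$. The BVASS $\mathcal B_k$ ($k\ge1$) has counters $d_1,\dots,d_k$ and $d'_1,\dots,d'_{k-1}$, with $\vec e_c$ the unit vector for counter $c$. $\mathcal B_1$ has states $q^{\mathrm{init}}_1,q^{\mathrm{leaf}}$ and a single unary rule $q^{\mathrm{init}}_1\xrightarrow{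 -2\vec e_{d_1}}q^{\mathrm{leaf}}$. For $k>1$, $\mathcal B_k$ consists of (the rules and states of) $\mathcal B_{k-1}$ together with new states $q^{\mathrm{init}}_k,q^1_k,q^2_k,q^{\mathrm{loop}}_k$ and rules: $q^{\mathrm{init}}_k\xrightarrow{\vec e_{d_{k-1}}}q^1_k$; $q^1_k\xrightarrow{ -\vec e_{d_{k-1}}+2\vec e_{d'_{k-1}}}q^1_k$; $q^1_k\xrightarrow{\vec 0}q^2_k$; $q^2_k\xrightarrow{ -\vec e_{d'_{k-1}}+\vec e_{d_{k-1}}}q^2_k$; split $q^2_k\to q^{\mathrm{loop}}_k+q^{\mathrm{loop}}_k$; $q^{\mathrm{loop}}_k\xrightarrow{\vec 0}q^{\mathrm{init}}_k$; $q^{\mathrm{loop}}_k\xrightarrow{ -\vec e_{d_k}}q^{\mathrm{init}}_{k-1}$. -}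

module Defs where

open import Data.Nat using (ℕ; zero; suc; _≤_; _<_; _^_; _≡ᵇ_; s≤s; z≤n)
open import Data.Nat.Properties using (≤-refl; <⇒≤; ≤-trans; n≤1+n)
open import Data.Integer as ℤ using (ℤ; +_; -_)
open import Data.Bool using (Bool; true; false; if_then_else_)
open import Data.Product using (Σ; _×_; _,_)
open import Data.Unit using (⊤)
open import Relation.Binary.PropositionalEquality using (_≡_)

tower : ℕ → ℕ
tower zero    = 1
tower (suc n) = 2 ^ tower n

record BVASS : Set₁ where
  field
    State   : Set
    Counter : Set
    Unary   : State → (Counter → ℤ) → State → Set
    Split   : State → State → State → Set

module _ (B : BVASS) where
  open BVASS B

  data DTree : State → (Counter → ℕ) → Set where
    leafNode : ∀ q v → DTree q v
    -- unary rule: child labelled (q₁ , v + u), v + u must be nonnegative,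
    -- i.e. a natural vector v₁ with v₁ = v + u pointwise in ℤ
    unaryNode : ∀ {q q₁ u v} (v₁ : Counter → ℕ) →
                Unary q u q₁ →
                (∀ c → + (v₁ c) ≡ (+ (v c)) ℤ.+ u c) →
                DTree q₁ v₁ → DTree q v
    splitNode : ∀ {q q₁ q₂ v} (v₁ v₂ : Counter → ℕ) →
                Split q q₁ q₂ →
                (∀ c → v c ≡ v₁ c Data.Nat.+ v₂ c) →
                DTree q₁ v₁ → DTree q₂ v₂ → DTree q v

  LeafCovering : State → ∀ {q v} → DTree q v → Set
  LeafCovering ql (leafNode q v) = q ≡ ql
  LeafCovering ql (unaryNode _ _ _ t) = LeafCovering ql t
  LeafCovering ql (splitNode _ _ _ _ t₁ t₂) = LeafCovering ql t₁ × LeafCovering ql t₂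

  HasCoveringTree : State → (Counter → ℕ) → State → Set
  HasCoveringTree q v₀ ql = Σ (DTree q v₀) (LeafCovering ql)

-- The BVASS B_k.
-- Counters: d i (1 ≤ i ≤ k) and d' i (1 ≤ i < k). Proof arguments are
-- irrelevant, so counters are determined by their kind and index.

data Counter (k : ℕ) : Set where
  d  : (i : ℕ) → .(1 ≤ i) → .(i ≤ k) → Counter k
  d' : (i : ℕ) → .(1 ≤ i) → .(i < k) → Counter k

data State (k : ℕ) : Set where
  qleaf : State k
  qinit : (i : ℕ) → .(1 ≤ i) → .(i ≤ k) → State k
  q1    : (i : ℕ) → .(2 ≤ i) → .(i ≤ k) → State k
  q2    : (i : ℕ) → .(2 ≤ i) → .(i ≤ k) → State k
  qloop : (i : ℕ) → .(2 ≤ i) → .(i ≤ k) → State k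

sameCounter : ∀ {k} → Counter k → Counter k → Bool
sameCounter (d i _ _)  (d j _ _)  = i ≡ᵇ j
sameCounter (d' i _ _) (d' j _ _) = i ≡ᵇ j
sameCounter _ _ = false

e : ∀ {k} → Counter k → Counter k → ℤ
e c c' = if sameCounter c c' then + 1 else + 0

𝟎 : ∀ {k} → Counter k → ℤ
𝟎 _ = + 0

-- Unary rules of B_k: the rule of B_1 (present in every B_k, k ≥ 1) and,
-- for every level j = suc m with 2 ≤ j ≤ k, the rules added in B_j.
data UnaryB (k : ℕ) : State k → (Counter k → ℤ) → State k → Set where
  r-base : (hk : 1 ≤ k) →
    UnaryB k (qinit 1 ≤-refl hk) (λ c → - (+ 2) ℤ.* e (d 1 ≤-refl hk) c) qleaf
  r-init : ∀ m (h : 1 ≤ m) (hk : suc m ≤ k) →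
    UnaryB k (qinit (suc m) (s≤s z≤n) hk)
             (e (d m h (<⇒≤ hk)))
             (q1 (suc m) (s≤s h) hk)
  r-one : ∀ m (h : 1 ≤ m) (hk : suc m ≤ k) →
    UnaryB k (q1 (suc m) (s≤s h) hk)
             (λ c → - e (d m h (<⇒≤ hk)) c ℤ.+ + 2 ℤ.* e (d' m h hk) c)
             (q1 (suc m) (s≤s h) hk)
  r-onetwo : ∀ m (h : 1 ≤ m) (hk : suc m ≤ k) →
    UnaryB k (q1 (suc m) (s≤s h) hk) 𝟎 (q2 (suc m) (s≤s h) hk)
  r-two : ∀ m (h : 1 ≤ m) (hk : suc m ≤ k) →
    UnaryB k (q2 (suc m) (s≤s h) hk)
             (λ c → - e (d' m h hk) c ℤ.+ e (d m h (<⇒≤ hk)) c)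
             (q2 (suc m) (s≤s h) hk)
  r-loop : ∀ m (h : 1 ≤ m) (hk : suc m ≤ k) →
    UnaryB k (qloop (suc m) (s≤s h) hk) 𝟎 (qinit (suc m) (s≤s z≤n) hk)
  r-exit : ∀ m (h : 1 ≤ m) (hk : suc m ≤ k) →
    UnaryB k (qloop (suc m) (s≤s h) hk)
             (λ c → - e (d (suc m) (s≤s z≤n) hk) c)
             (qinit m h (<⇒≤ hk))

data SplitB (k : ℕ) : State k → State k → State k → Set where
  r-split : ∀ m (h : 1 ≤ m) (hk : suc m ≤ k) →
    SplitB k (q2 (suc m) (s≤s h) hk) (qloop (suc m) (s≤s h) hk) (qloop (suc m) (s≤s h) hk)

𝓑 : ℕ → BVASS
𝓑 k = record
  { State   = State k
  ; Counter = Counter k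
  ; Unary   = UnaryB k
  ; Split   = SplitB k
  }

module Submission where

-- Argue one level at a time. The rules of 𝓑 (m + 1) only touch dₘ, d'ₘ and dₘ₊₁ and keep all
-- lower counters at 0; write x, y, n for the values of these three counters. A round
-- qinit → q¹ → q² → split turns (x, y) into two children whose values of x + y add up to at most
-- 2 (x + y + 1), and every branch must finally spend one dₘ₊₁-token to enter qinitₘ, which by
-- induction on the level requires x ≥ tower m. Hence 2 ^ (tower m ∸ (x + y)) ≤ n at qinitₘ₊₁:
-- at a split with budget W either one child stays within W, or both stay within W + 1 and each
-- needs half as many tokens. Conversely, r rounds starting from x with 2 ^ r tokens, split evenly
-- at every round, reach qinitₘ with x + r. Starting from x = y = 0 both bounds are exactly
-- tower (m + 1) = 2 ^ tower m.

open import Defs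
open import Data.Bool using (true; false; if_then_else_)
open import Data.Bool.Properties using (T-≡)
open import Data.Integer as ℤ using (ℤ; +_; -[1+_]; _⊖_; 0ℤ; ∣_∣; +≤+)
open import Data.Integer.Properties using (+-injective; [1+m]⊖[1+n]≡m⊖n; 0≤i⇒+∣i∣≡i; ⊖-≥)
open import Data.Nat using (ℕ; zero; suc; pred; _+_; _∸_; _^_; _≤_; _<_; _≡ᵇ_; _⊓_; s≤s; z≤n)
open import Data.Nat.Properties
open import Data.Nat.Tactic.RingSolver using (solve-∀)
open import Data.Product using (_×_; _,_; proj₁; proj₂)
open import Data.Sum using (_⊎_; inj₁; inj₂)
open import Function.Base using (_∘_)
open import Function.Bundles using (Equivalence; _⇔_; mk⇔)
open import Relation.Binary.PropositionalEquality
open import Relation.Nullary using (yes; no; contradiction)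

+≡⊖⇒≡+ : ∀ {a} b n → + a ≡ b ⊖ n → b ≡ n + a
+≡⊖⇒≡+ b       zero    eq = +-injective (sym eq)
+≡⊖⇒≡+ zero    (suc n) ()
+≡⊖⇒≡+ (suc b) (suc n) eq = cong suc (+≡⊖⇒≡+ b n (trans eq ([1+m]⊖[1+n]≡m⊖n b n)))

+≡+z⇒≡+ : ∀ {a b z n} → + a ≡ + b ℤ.+ z → z ≡ + n → a ≡ b + n
+≡+z⇒≡+ eq refl = +-injective eq

+≡+z⇒≡ : ∀ {a b z} → + a ≡ + b ℤ.+ z → z ≡ + 0 → a ≡ b
+≡+z⇒≡ {b = b} eq z≡0 = trans (+≡+z⇒≡+ eq z≡0) (+-identityʳ b)

+≡+z⇒+≡ : ∀ {a b z n} → + a ≡ + b ℤ.+ z → z ≡ -[1+ n ] → b ≡ suc n + a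
+≡+z⇒+≡ {b = b} eq refl = +≡⊖⇒≡+ b _ eq

0≤+a+z : ∀ a {z} j → z ≡ + j → 0ℤ ℤ.≤ + a ℤ.+ z
0≤+a+z a j refl = +≤+ z≤n

0≤+a-z : ∀ {a z} j → z ≡ -[1+ j ] → suc j ≤ a → 0ℤ ℤ.≤ + a ℤ.+ z
0≤+a-z j refl j<a = subst (0ℤ ℤ.≤_) (sym (⊖-≥ j<a)) (+≤+ z≤n)

2^[T∸-]-antitone : ∀ T {a b} → a ≤ b → 2 ^ (T ∸ b) ≤ 2 ^ (T ∸ a)
2^[T∸-]-antitone T a≤b = ^-monoʳ-≤ 2 (∸-monoʳ-≤ T a≤b)

m∸n≤1+m∸[1+n] : ∀ m n → m ∸ n ≤ suc (m ∸ suc n)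
m∸n≤1+m∸[1+n] zero    zero    = z≤n
m∸n≤1+m∸[1+n] zero    (suc n) = z≤n
m∸n≤1+m∸[1+n] (suc m) zero    = ≤-refl
m∸n≤1+m∸[1+n] (suc m) (suc n) = m∸n≤1+m∸[1+n] m n

2^[T∸W]≤2*2^[T∸1+W] : ∀ T W → 2 ^ (T ∸ W) ≤ 2 ^ (T ∸ suc W) + 2 ^ (T ∸ suc W)
2^[T∸W]≤2*2^[T∸1+W] T W = begin
  2 ^ (T ∸ W)                       ≤⟨ ^-monoʳ-≤ 2 (m∸n≤1+m∸[1+n] T W) ⟩
  2 ^ suc (T ∸ suc W)               ≡⟨ cong (λ x → 2 ^ (T ∸ suc W) + x) (+-identityʳ _) ⟩
  2 ^ (T ∸ suc W) + 2 ^ (T ∸ suc W) ∎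
  where open ≤-Reasoning

2^[T∸W]≤2^[T∸a]+2^[T∸b] : ∀ T W a b → a + b ≤ suc W + suc W →
                          2 ^ (T ∸ W) ≤ 2 ^ (T ∸ a) + 2 ^ (T ∸ b)
2^[T∸W]≤2^[T∸a]+2^[T∸b] T W a b a+b≤ with a ≤? W | b ≤? W
... | yes a≤W | _ = ≤-trans (2^[T∸-]-antitone T a≤W) (m≤m+n _ _)
... | no _ | yes b≤W = ≤-trans (2^[T∸-]-antitone T b≤W) (m≤n+m _ _)
... | no a≰W | no b≰W = ≤-trans (2^[T∸W]≤2*2^[T∸1+W] T W)
                          (+-mono-≤ (2^[T∸-]-antitone T a≤1+W) (2^[T∸-]-antitone T b≤1+W))
  where
  a≤1+W : a ≤ suc W
  a≤1+W = +-cancelʳ-≤ b a (suc W) (≤-trans a+b≤ (+-monoʳ-≤ (suc W) (≰⇒> b≰W)))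
  b≤1+W : b ≤ suc W
  b≤1+W = +-cancelˡ-≤ a b (suc W) (≤-trans a+b≤ (+-monoˡ-≤ (suc W) (≰⇒> a≰W)))

≡ᵇ-refl : ∀ n → (n ≡ᵇ n) ≡ true
≡ᵇ-refl n = Equivalence.to T-≡ (≡⇒≡ᵇ n n refl)

≢⇒≡ᵇ≡false : ∀ {m n} → m ≢ n → (m ≡ᵇ n) ≡ false
≢⇒≡ᵇ≡false {m} {n} m≢n with m ≡ᵇ n in eq
... | false = refl
... | true  = contradiction (≡ᵇ⇒≡ m n (Equivalence.from T-≡ eq)) m≢n

module _ {k : ℕ} where

  level : Counter k → ℕ
  level (d  i _ _) = i
  level (d' i _ _) = i

  e-self : (c : Counter k) → e c c ≡ + 1
  e-self (d  i _ _) rewrite ≡ᵇ-refl i = refl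
  e-self (d' i _ _) rewrite ≡ᵇ-refl i = refl

  e-apart : (c c' : Counter k) → level c ≢ level c' → e c c' ≡ + 0
  e-apart (d  i _ _) (d  j _ _) i≢j rewrite ≢⇒≡ᵇ≡false i≢j = refl
  e-apart (d  i _ _) (d' j _ _) _   = refl
  e-apart (d' i _ _) (d  j _ _) _   = refl
  e-apart (d' i _ _) (d' j _ _) i≢j rewrite ≢⇒≡ᵇ≡false i≢j = refl

  e-below : (c₀ c : Counter k) → level c < level c₀ → e c₀ c ≡ + 0
  e-below c₀ c lc<lc₀ = e-apart c₀ c (>⇒≢ lc<lc₀)

  e-cases : (c c' : Counter k) → e c c' ≡ + 0 ⊎ c ≡ c'
  e-cases c@(d i _ _) c'@(d j _ _) with i ≟ j
  ... | yes refl = inj₂ refl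
  ... | no  i≢j  = inj₁ (e-apart c c' i≢j)
  e-cases (d  i _ _) (d' j _ _) = inj₁ refl
  e-cases (d' i _ _) (d  j _ _) = inj₁ refl
  e-cases c@(d' i _ _) c'@(d' j _ _) with i ≟ j
  ... | yes refl = inj₂ refl
  ... | no  i≢j  = inj₁ (e-apart c c' i≢j)

  ZeroBelow : ℕ → (Counter k → ℕ) → Set
  ZeroBelow m v = ∀ c → level c < m → v c ≡ 0

  Moves : (Counter k → ℕ) → (Counter k → ℤ) → (Counter k → ℕ) → Set
  Moves v u v₁ = ∀ c → + v₁ c ≡ + v c ℤ.+ u c

  moves-ZeroBelow : ∀ {m v u v₁} → (∀ c → level c < m → u c ≡ + 0) →
                    Moves v u v₁ → ZeroBelow m v → ZeroBelow m v₁
  moves-ZeroBelow u-below mv z c lc<m = trans (+≡+z⇒≡ (mv c) (u-below c lc<m)) (z c lc<m)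

  Fireable : (Counter k → ℕ) → (Counter k → ℤ) → Set
  Fireable v u = ∀ c → 0ℤ ℤ.≤ + v c ℤ.+ u c

  _⊕_ : (Counter k → ℕ) → (Counter k → ℤ) → Counter k → ℕ
  (v ⊕ u) c = ∣ + v c ℤ.+ u c ∣

  moves-⊕ : ∀ v u → Fireable v u → Moves v u (v ⊕ u)
  moves-⊕ v u f c = 0≤i⇒+∣i∣≡i (f c)

  moves-𝟎 : ∀ {v v₁} → Moves v 𝟎 v₁ → ∀ c → v₁ c ≡ v c
  moves-𝟎 mv c = +≡+z⇒≡ (mv c) refl

  moves-𝟎-ZeroBelow : ∀ {m v v₁} → Moves v 𝟎 v₁ → ZeroBelow m v → ZeroBelow m v₁
  moves-𝟎-ZeroBelow = moves-ZeroBelow (λ _ _ → refl)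

  𝟎-fireable : ∀ v → Fireable v 𝟎
  𝟎-fireable v c = +≤+ z≤n

  ZeroBelow-weaken : ∀ {m v} → ZeroBelow (suc m) v → ZeroBelow m v
  ZeroBelow-weaken z c lc<m = z c (m<n⇒m<1+n lc<m)

  ZeroBelow-split : ∀ {m v v₁ v₂} → (∀ c → v c ≡ v₁ c + v₂ c) →
                    ZeroBelow m v → ZeroBelow m v₁ × ZeroBelow m v₂
  ZeroBelow-split {v₁ = v₁} v≡v₁+v₂ z =
    (λ c lc<m → m+n≡0⇒m≡0 (v₁ c) (trans (sym (v≡v₁+v₂ c)) (z c lc<m))) ,
    (λ c lc<m → m+n≡0⇒n≡0 (v₁ c) (trans (sym (v≡v₁+v₂ c)) (z c lc<m)))

  Coverable : State k → (Counter k → ℕ) → Set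
  Coverable q v = HasCoveringTree (𝓑 k) q v qleaf

  fire : ∀ {q q₁ u v} → UnaryB k q u q₁ → Fireable v u → Coverable q₁ (v ⊕ u) → Coverable q v
  fire {u = u} {v} r f (t , cov) = unaryNode (v ⊕ u) r (moves-⊕ v u f) t , cov

module Layer {k : ℕ} (m : ℕ) (h : 1 ≤ m) (hk : suc m ≤ k) where

  dₘ d'ₘ dₘ₊₁ : Counter k
  dₘ   = d m h (<⇒≤ hk)
  d'ₘ  = d' m h hk
  dₘ₊₁ = d (suc m) (s≤s z≤n) hk

  qinitₘ qinitₘ₊₁ q¹ₘ₊₁ q²ₘ₊₁ qloopₘ₊₁ : State k
  qinitₘ    = qinit m h (<⇒≤ hk)
  qinitₘ₊₁  = qinit (suc m) (s≤s z≤n) hk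
  q¹ₘ₊₁     = q1 (suc m) (s≤s h) hk
  q²ₘ₊₁     = q2 (suc m) (s≤s h) hk
  qloopₘ₊₁  = qloop (suc m) (s≤s h) hk

  u-one u-two u-exit : Counter k → ℤ
  u-one  c = ℤ.- e dₘ c ℤ.+ + 2 ℤ.* e d'ₘ c
  u-two  c = ℤ.- e d'ₘ c ℤ.+ e dₘ c
  u-exit c = ℤ.- e dₘ₊₁ c

  m≢1+m : m ≢ suc m
  m≢1+m = <⇒≢ (n<1+n m)

  u-one-dₘ : u-one dₘ ≡ -[1+ 0 ]
  u-one-dₘ rewrite e-self dₘ = refl

  u-one-d'ₘ : u-one d'ₘ ≡ + 2
  u-one-d'ₘ rewrite e-self d'ₘ = refl

  u-one-dₘ₊₁ : u-one dₘ₊₁ ≡ + 0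
  u-one-dₘ₊₁ rewrite e-apart dₘ dₘ₊₁ m≢1+m = refl

  u-two-d'ₘ : u-two d'ₘ ≡ -[1+ 0 ]
  u-two-d'ₘ rewrite e-self d'ₘ = refl

  u-two-dₘ : u-two dₘ ≡ + 1
  u-two-dₘ rewrite e-self dₘ = refl

  u-two-dₘ₊₁ : u-two dₘ₊₁ ≡ + 0
  u-two-dₘ₊₁ rewrite e-apart dₘ dₘ₊₁ m≢1+m = refl

  u-exit-dₘ₊₁ : u-exit dₘ₊₁ ≡ -[1+ 0 ]
  u-exit-dₘ₊₁ rewrite e-self dₘ₊₁ = refl

  u-exit-dₘ : u-exit dₘ ≡ + 0
  u-exit-dₘ rewrite e-apart dₘ₊₁ dₘ (m≢1+m ∘ sym) = refl

  init-below : ∀ c → level c < m → e dₘ c ≡ + 0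
  init-below = e-below dₘ

  one-below : ∀ c → level c < m → u-one c ≡ + 0
  one-below c lc<m rewrite e-below dₘ c lc<m | e-below d'ₘ c lc<m = refl

  two-below : ∀ c → level c < m → u-two c ≡ + 0
  two-below c lc<m rewrite e-below dₘ c lc<m | e-below d'ₘ c lc<m = refl

  exit-below : ∀ c → level c < m → u-exit c ≡ + 0
  exit-below c lc<m rewrite e-below dₘ₊₁ c (m<n⇒m<1+n lc<m) = refl

  module _ {v v₁ : Counter k → ℕ} where

    init-dₘ : Moves v (e dₘ) v₁ → v₁ dₘ ≡ v dₘ + 1
    init-dₘ mv = +≡+z⇒≡+ (mv dₘ) (e-self dₘ)

    init-d'ₘ : Moves v (e dₘ) v₁ → v₁ d'ₘ ≡ v d'ₘ
    init-d'ₘ mv = +≡+z⇒≡ (mv d'ₘ) refl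

    init-dₘ₊₁ : Moves v (e dₘ) v₁ → v₁ dₘ₊₁ ≡ v dₘ₊₁
    init-dₘ₊₁ mv = +≡+z⇒≡ (mv dₘ₊₁) (e-apart dₘ dₘ₊₁ m≢1+m)

    one-dₘ : Moves v u-one v₁ → v dₘ ≡ suc (v₁ dₘ)
    one-dₘ mv = +≡+z⇒+≡ (mv dₘ) u-one-dₘ

    one-d'ₘ : Moves v u-one v₁ → v₁ d'ₘ ≡ v d'ₘ + 2
    one-d'ₘ mv = +≡+z⇒≡+ (mv d'ₘ) u-one-d'ₘ

    one-dₘ₊₁ : Moves v u-one v₁ → v₁ dₘ₊₁ ≡ v dₘ₊₁
    one-dₘ₊₁ mv = +≡+z⇒≡ (mv dₘ₊₁) u-one-dₘ₊₁

    two-dₘ : Moves v u-two v₁ → v₁ dₘ ≡ v dₘ + 1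
    two-dₘ mv = +≡+z⇒≡+ (mv dₘ) u-two-dₘ

    two-d'ₘ : Moves v u-two v₁ → v d'ₘ ≡ suc (v₁ d'ₘ)
    two-d'ₘ mv = +≡+z⇒+≡ (mv d'ₘ) u-two-d'ₘ

    two-dₘ₊₁ : Moves v u-two v₁ → v₁ dₘ₊₁ ≡ v dₘ₊₁
    two-dₘ₊₁ mv = +≡+z⇒≡ (mv dₘ₊₁) u-two-dₘ₊₁

    exit-dₘ : Moves v u-exit v₁ → v₁ dₘ ≡ v dₘ
    exit-dₘ mv = +≡+z⇒≡ (mv dₘ) u-exit-dₘ

    exit-dₘ₊₁ : Moves v u-exit v₁ → v dₘ₊₁ ≡ suc (v₁ dₘ₊₁)
    exit-dₘ₊₁ mv = +≡+z⇒+≡ (mv dₘ₊₁) u-exit-dₘ₊₁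

  init-fireable : ∀ v → Fireable v (e dₘ)
  init-fireable v c with e-cases dₘ c
  ... | inj₁ e≡0  = 0≤+a+z _ 0 e≡0
  ... | inj₂ refl = 0≤+a+z _ 1 (e-self dₘ)

  one-fireable : ∀ {v} → 1 ≤ v dₘ → Fireable v u-one
  one-fireable 1≤x c with e-cases dₘ c | e-cases d'ₘ c
  ... | inj₂ refl | _         = 0≤+a-z 0 u-one-dₘ 1≤x
  ... | inj₁ _    | inj₂ refl = 0≤+a+z _ 2 u-one-d'ₘ
  ... | inj₁ e≡0  | inj₁ e'≡0 rewrite e≡0 | e'≡0 = +≤+ z≤n

  two-fireable : ∀ {v} → 1 ≤ v d'ₘ → Fireable v u-two
  two-fireable 1≤y c with e-cases d'ₘ c | e-cases dₘ c
  ... | inj₂ refl | _         = 0≤+a-z 0 u-two-d'ₘ 1≤y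
  ... | inj₁ _    | inj₂ refl = 0≤+a+z _ 1 u-two-dₘ
  ... | inj₁ e'≡0 | inj₁ e≡0 rewrite e≡0 | e'≡0 = +≤+ z≤n

  exit-fireable : ∀ {v} → 1 ≤ v dₘ₊₁ → Fireable v u-exit
  exit-fireable 1≤n c with e-cases dₘ₊₁ c
  ... | inj₂ refl = 0≤+a-z 0 u-exit-dₘ₊₁ 1≤n
  ... | inj₁ e≡0 rewrite e≡0 = +≤+ z≤n

module Base {k : ℕ} (hk : 1 ≤ k) where

  d₁ : Counter k
  d₁ = d 1 ≤-refl hk

  u-base : Counter k → ℤ
  u-base c = ℤ.- (+ 2) ℤ.* e d₁ c

  u-base-d₁ : u-base d₁ ≡ -[1+ 1 ]
  u-base-d₁ rewrite e-self d₁ = refl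

  base-d₁ : ∀ {v v₁} → Moves v u-base v₁ → v d₁ ≡ 2 + v₁ d₁
  base-d₁ mv = +≡+z⇒+≡ (mv d₁) u-base-d₁

  base-fireable : ∀ {v} → 2 ≤ v d₁ → Fireable v u-base
  base-fireable 2≤v c with e-cases d₁ c
  ... | inj₂ refl = 0≤+a-z 1 u-base-d₁ 2≤v
  ... | inj₁ e≡0 rewrite e≡0 = +≤+ z≤n

module Soundness {k : ℕ} (m : ℕ) (h : 1 ≤ m) (hk : suc m ≤ k) where
  open Layer m h hk

  Covers : ∀ {q v} → DTree (𝓑 k) q v → Set
  Covers = LeafCovering (𝓑 k) qleaf

  module _ (top : ∀ {v} → Coverable qinitₘ v → ZeroBelow m v → tower m ≤ v dₘ) where

    mutual
      init-bound : ∀ {v} (t : DTree (𝓑 k) qinitₘ₊₁ v) → Covers t → ZeroBelow m v →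
                   2 ^ (tower m ∸ (v dₘ + v d'ₘ)) ≤ v dₘ₊₁
      init-bound (leafNode _ _) ()
      init-bound {v} (unaryNode v₁ (r-init _ _ _) mv t) cov z =
        subst (_ ≤_) (init-dₘ₊₁ mv)
          (q¹-bound t cov (moves-ZeroBelow init-below mv z) (x + y) mass₁≤)
        where
        x = v dₘ
        y = v d'ₘ
        mass₁≤ : v₁ dₘ + v₁ dₘ + v₁ d'ₘ ≤ suc (x + y) + suc (x + y)
        mass₁≤ rewrite init-dₘ mv | init-d'ₘ mv = ≤-trans (m≤m+n _ y) (≤-reflexive (doubling x y))
          where
          doubling : ∀ x y → x + 1 + (x + 1) + y + y ≡ suc (x + y) + suc (x + y)
          doubling = solve-∀

      -- In q¹ every dₘ-token is still to become two d'ₘ-tokens.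
      q¹-bound : ∀ {v} (t : DTree (𝓑 k) q¹ₘ₊₁ v) → Covers t → ZeroBelow m v →
                 ∀ W → v dₘ + v dₘ + v d'ₘ ≤ suc W + suc W → 2 ^ (tower m ∸ W) ≤ v dₘ₊₁
      q¹-bound (leafNode _ _) ()
      q¹-bound {v} (unaryNode v₁ (r-one _ _ _) mv t) cov z W mass≤ =
        subst (_ ≤_) (one-dₘ₊₁ mv)
          (q¹-bound t cov (moves-ZeroBelow one-below mv z) W (subst (_≤ suc W + suc W) mass≡ mass≤))
        where
        mass≡ : v dₘ + v dₘ + v d'ₘ ≡ v₁ dₘ + v₁ dₘ + v₁ d'ₘ
        mass≡ rewrite one-dₘ mv | one-d'ₘ mv = shift (v₁ dₘ) (v d'ₘ)
          where
          shift : ∀ x y → suc x + suc x + y ≡ x + x + (y + 2)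
          shift = solve-∀
      q¹-bound {v} (unaryNode v₁ (r-onetwo _ _ _) mv t) cov z W mass≤ =
        subst (_ ≤_) (v₁≗v dₘ₊₁) (q²-bound t cov (moves-𝟎-ZeroBelow mv z) W mass₁≤)
        where
        v₁≗v = moves-𝟎 mv
        mass₁≤ : v₁ dₘ + v₁ d'ₘ ≤ suc W + suc W
        mass₁≤ rewrite v₁≗v dₘ | v₁≗v d'ₘ | +-assoc (v dₘ) (v dₘ) (v d'ₘ) =
          ≤-trans (m≤n+m _ (v dₘ)) mass≤

      q²-bound : ∀ {v} (t : DTree (𝓑 k) q²ₘ₊₁ v) → Covers t → ZeroBelow m v →
                 ∀ W → v dₘ + v d'ₘ ≤ suc W + suc W → 2 ^ (tower m ∸ W) ≤ v dₘ₊₁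
      q²-bound (leafNode _ _) ()
      q²-bound {v} (unaryNode v₁ (r-two _ _ _) mv t) cov z W mass≤ =
        subst (_ ≤_) (two-dₘ₊₁ mv)
          (q²-bound t cov (moves-ZeroBelow two-below mv z) W (subst (_≤ suc W + suc W) mass≡ mass≤))
        where
        mass≡ : v dₘ + v d'ₘ ≡ v₁ dₘ + v₁ d'ₘ
        mass≡ rewrite two-d'ₘ mv | two-dₘ mv = sym (+-assoc (v dₘ) 1 (v₁ d'ₘ))
      q²-bound {v} (splitNode v₁ v₂ (r-split _ _ _) v≡v₁+v₂ t₁ t₂) (cov₁ , cov₂) z W mass≤ =
        begin
          2 ^ (tower m ∸ W)
            ≤⟨ 2^[T∸W]≤2^[T∸a]+2^[T∸b] (tower m) W (v₁ dₘ + v₁ d'ₘ) (v₂ dₘ + v₂ d'ₘ) masses≤ ⟩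
          2 ^ (tower m ∸ (v₁ dₘ + v₁ d'ₘ)) + 2 ^ (tower m ∸ (v₂ dₘ + v₂ d'ₘ))
            ≤⟨ +-mono-≤ (loop-bound t₁ cov₁ (proj₁ z₁,₂)) (loop-bound t₂ cov₂ (proj₂ z₁,₂)) ⟩
          v₁ dₘ₊₁ + v₂ dₘ₊₁
            ≡⟨ v≡v₁+v₂ dₘ₊₁ ⟨
          v dₘ₊₁ ∎
        where
        open ≤-Reasoning
        z₁,₂ = ZeroBelow-split v≡v₁+v₂ z
        masses≤ : (v₁ dₘ + v₁ d'ₘ) + (v₂ dₘ + v₂ d'ₘ) ≤ suc W + suc W
        masses≤ rewrite v≡v₁+v₂ dₘ | v≡v₁+v₂ d'ₘ =
          subst (_≤ suc W + suc W) (regroup (v₁ dₘ) (v₂ dₘ) (v₁ d'ₘ) (v₂ d'ₘ)) mass≤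
          where
          regroup : ∀ a b c d → a + b + (c + d) ≡ a + c + (b + d)
          regroup = solve-∀

      loop-bound : ∀ {v} (t : DTree (𝓑 k) qloopₘ₊₁ v) → Covers t → ZeroBelow m v →
                   2 ^ (tower m ∸ (v dₘ + v d'ₘ)) ≤ v dₘ₊₁
      loop-bound (leafNode _ _) ()
      loop-bound {v} (unaryNode v₁ (r-loop _ _ _) mv t) cov z
        rewrite sym (moves-𝟎 mv dₘ) | sym (moves-𝟎 mv d'ₘ) | sym (moves-𝟎 mv dₘ₊₁) =
        init-bound t cov (moves-𝟎-ZeroBelow mv z)
      loop-bound {v} (unaryNode v₁ (r-exit _ _ _) mv t) cov z = begin
        2 ^ (tower m ∸ (v dₘ + v d'ₘ)) ≡⟨ cong (2 ^_) (m≤n⇒m∸n≡0 T≤x+y) ⟩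
        1                              ≤⟨ s≤s z≤n ⟩
        suc (v₁ dₘ₊₁)                  ≡⟨ exit-dₘ₊₁ mv ⟨
        v dₘ₊₁                         ∎
        where
        open ≤-Reasoning
        T≤x+y : tower m ≤ v dₘ + v d'ₘ
        T≤x+y = ≤-trans (top (t , cov) (moves-ZeroBelow exit-below mv z))
                        (≤-trans (≤-reflexive (exit-dₘ mv)) (m≤m+n (v dₘ) (v d'ₘ)))

coverable⇒tower≤ : ∀ {k} m (h : 1 ≤ m) (p : m ≤ k) {v} →
            Coverable (qinit m h p) v → ZeroBelow m v → tower m ≤ v (d m h p)
coverable⇒tower≤ 1 h p (leafNode _ _ , ()) z
coverable⇒tower≤ 1 h p (unaryNode v₁ (r-base _) mv t , cov) z =
  subst (2 ≤_) (sym (Base.base-d₁ p mv)) (m≤m+n 2 _)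
coverable⇒tower≤ 1 h p (unaryNode v₁ (r-init _ () _) mv t , cov) z
coverable⇒tower≤ (suc (suc m)) h p {v} (t , cov) z =
  subst (λ w → 2 ^ (tower (suc m) ∸ w) ≤ v (d (suc (suc m)) h p))
        (cong₂ _+_ (z dₘ ≤-refl) (z d'ₘ ≤-refl))
        (Soundness.init-bound (suc m) (s≤s z≤n) p (coverable⇒tower≤ (suc m) (s≤s z≤n) (<⇒≤ p))
                              t cov (ZeroBelow-weaken z))
  where open Layer (suc m) (s≤s z≤n) p using (dₘ; d'ₘ)

module Completeness {k : ℕ} (m : ℕ) (h : 1 ≤ m) (hk : suc m ≤ k) where
  open Layer m h hk

  CoverableAt : State k → ℕ → ℕ → ℕ → Set
  CoverableAt q x y n = ∀ {v} → ZeroBelow m v → v dₘ ≡ x → v d'ₘ ≡ y → v dₘ₊₁ ≡ n → Coverable q v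

  q²-drain : ∀ {x n} b → CoverableAt q²ₘ₊₁ (x + b) 0 n → CoverableAt q²ₘ₊₁ x b n
  q²-drain {x} zero cover z x≡ y≡ n≡ = cover z (trans x≡ (sym (+-identityʳ x))) y≡ n≡
  q²-drain {x} {n} (suc b) cover {v} z x≡ y≡ n≡ =
    fire (r-two m h hk) f
      (q²-drain b cover′ (moves-ZeroBelow two-below mv z)
        (trans (two-dₘ mv) (cong (_+ 1) x≡))
        (suc-injective (trans (sym (two-d'ₘ mv)) y≡))
        (trans (two-dₘ₊₁ mv) n≡))
    where
    f : Fireable v u-two
    f = two-fireable (subst (1 ≤_) (sym y≡) (s≤s z≤n))
    mv : Moves v u-two (v ⊕ u-two)
    mv = moves-⊕ v u-two f
    cover′ : CoverableAt q²ₘ₊₁ (x + 1 + b) 0 n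
    cover′ = subst (λ a → CoverableAt q²ₘ₊₁ a 0 n) (sym (+-assoc x 1 b)) cover

  q¹-drain : ∀ {y n} a → CoverableAt q²ₘ₊₁ 0 (y + (a + a)) n → CoverableAt q¹ₘ₊₁ a y n
  q¹-drain {y} zero cover {v} z x≡ y≡ n≡ =
    fire (r-onetwo m h hk) (𝟎-fireable v)
      (cover (moves-𝟎-ZeroBelow mv z) (trans (moves-𝟎 mv dₘ) x≡)
        (trans (moves-𝟎 mv d'ₘ) (trans y≡ (sym (+-identityʳ y)))) (trans (moves-𝟎 mv dₘ₊₁) n≡))
    where
    mv : Moves v 𝟎 (v ⊕ 𝟎)
    mv = moves-⊕ v 𝟎 (𝟎-fireable v)
  q¹-drain {y} {n} (suc a) cover {v} z x≡ y≡ n≡ =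
    fire (r-one m h hk) f
      (q¹-drain a cover′ (moves-ZeroBelow one-below mv z)
        (suc-injective (trans (sym (one-dₘ mv)) x≡))
        (trans (one-d'ₘ mv) (cong (_+ 2) y≡))
        (trans (one-dₘ₊₁ mv) n≡))
    where
    f : Fireable v u-one
    f = one-fireable (subst (1 ≤_) (sym x≡) (s≤s z≤n))
    mv : Moves v u-one (v ⊕ u-one)
    mv = moves-⊕ v u-one f
    cover′ : CoverableAt q²ₘ₊₁ 0 (y + 2 + (a + a)) n
    cover′ = subst (λ b → CoverableAt q²ₘ₊₁ 0 b n) (regroup y a) cover
      where
      regroup : ∀ y a → y + (suc a + suc a) ≡ y + 2 + (a + a)
      regroup = solve-∀

  split : ∀ {a b p n} → p ≤ n → CoverableAt qloopₘ₊₁ a 0 p → CoverableAt qloopₘ₊₁ b 0 (n ∸ p) →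
          CoverableAt q²ₘ₊₁ (a + b) 0 n
  split {a} {b} {p} {n} p≤n cover₁ cover₂ {v} z x≡ y≡ n≡ =
    splitNode v₁ v₂ (r-split m h hk) v≡v₁+v₂ (proj₁ c₁) (proj₁ c₂) , proj₂ c₁ , proj₂ c₂
    where
    share : Counter k → ℕ
    share c = if sameCounter dₘ c then a else if sameCounter dₘ₊₁ c then p else 0
    v₁ v₂ : Counter k → ℕ
    v₁ c = v c ⊓ share c
    v₂ c = v c ∸ v₁ c
    v≡v₁+v₂ : ∀ c → v c ≡ v₁ c + v₂ c
    v≡v₁+v₂ c = sym (m+[n∸m]≡n (m⊓n≤m (v c) (share c)))
    z₁,₂ = ZeroBelow-split v≡v₁+v₂ z
    v₁-dₘ : v₁ dₘ ≡ a
    v₁-dₘ rewrite ≡ᵇ-refl m | x≡ = m≥n⇒m⊓n≡n (m≤m+n a b)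
    v₁-dₘ₊₁ : v₁ dₘ₊₁ ≡ p
    v₁-dₘ₊₁ rewrite ≢⇒≡ᵇ≡false m≢1+m | ≡ᵇ-refl m | n≡ = m≥n⇒m⊓n≡n p≤n
    v₁-d'ₘ : v₁ d'ₘ ≡ 0
    v₁-d'ₘ = ⊓-zeroʳ (v d'ₘ)
    c₁ = cover₁ (proj₁ z₁,₂) v₁-dₘ v₁-d'ₘ v₁-dₘ₊₁
    c₂ = cover₂ (proj₂ z₁,₂)
           (trans (cong₂ _∸_ x≡ v₁-dₘ) (m+n∸m≡n a b))
           (cong₂ _∸_ y≡ v₁-d'ₘ)
           (cong₂ _∸_ n≡ v₁-dₘ₊₁)

  module _ (top : ∀ {v} → ZeroBelow m v → tower m ≤ v dₘ → Coverable qinitₘ v) where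

    mutual
      init-build : ∀ r {x n} → tower m ≤ x + suc r → 2 ^ suc r ≤ n → CoverableAt qinitₘ₊₁ x 0 n
      init-build r {x} {n} T≤ 2^≤n {v} z x≡ y≡ n≡ =
        fire (r-init m h hk) (init-fireable v)
          (q¹-drain (x + 1) (q²-drain (x + 1 + (x + 1)) (split 2^r≤n half half′))
            (moves-ZeroBelow init-below mv z)
            (trans (init-dₘ mv) (cong (_+ 1) x≡))
            (trans (init-d'ₘ mv) y≡)
            (trans (init-dₘ₊₁ mv) n≡))
        where
        mv : Moves v (e dₘ) (v ⊕ e dₘ)
        mv = moves-⊕ v (e dₘ) (init-fireable v)
        2^r+2^r≤n : 2 ^ r + 2 ^ r ≤ n
        2^r+2^r≤n = subst (_≤ n) (cong (_+_ (2 ^ r)) (+-identityʳ (2 ^ r))) 2^≤n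
        2^r≤n : 2 ^ r ≤ n
        2^r≤n = m+n≤o⇒m≤o (2 ^ r) 2^r+2^r≤n
        T≤x+1+r : tower m ≤ x + 1 + r
        T≤x+1+r = subst (tower m ≤_) (sym (+-assoc x 1 r)) T≤
        half : CoverableAt qloopₘ₊₁ (x + 1) 0 (2 ^ r)
        half = loop-build r T≤x+1+r ≤-refl
        half′ : CoverableAt qloopₘ₊₁ (x + 1) 0 (n ∸ 2 ^ r)
        half′ = loop-build r T≤x+1+r (m+n≤o⇒m≤o∸n (2 ^ r) 2^r+2^r≤n)

      loop-build : ∀ r {x n} → tower m ≤ x + r → 2 ^ r ≤ n → CoverableAt qloopₘ₊₁ x 0 n
      loop-build zero {x} T≤ 1≤n {v} z x≡ y≡ n≡ =
        fire (r-exit m h hk) f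
          (top (moves-ZeroBelow exit-below mv z) T≤x₁)
        where
        f : Fireable v u-exit
        f = exit-fireable (subst (1 ≤_) (sym n≡) 1≤n)
        mv : Moves v u-exit (v ⊕ u-exit)
        mv = moves-⊕ v u-exit f
        T≤x₁ : tower m ≤ (v ⊕ u-exit) dₘ
        T≤x₁ = subst (tower m ≤_) (sym (trans (exit-dₘ mv) x≡)) (subst (tower m ≤_) (+-identityʳ x) T≤)
      loop-build (suc r) T≤ 2^≤n {v} z x≡ y≡ n≡ =
        fire (r-loop m h hk) (𝟎-fireable v)
          (init-build r T≤ 2^≤n (moves-𝟎-ZeroBelow mv z)
            (trans (moves-𝟎 mv dₘ) x≡) (trans (moves-𝟎 mv d'ₘ) y≡) (trans (moves-𝟎 mv dₘ₊₁) n≡))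
        where
        mv : Moves v 𝟎 (v ⊕ 𝟎)
        mv = moves-⊕ v 𝟎 (𝟎-fireable v)

tower≤⇒coverable : ∀ {k} m (h : 1 ≤ m) (p : m ≤ k) {v} →
               ZeroBelow m v → tower m ≤ v (d m h p) → Coverable (qinit m h p) v
tower≤⇒coverable 1 h p z T≤ = fire (r-base p) (Base.base-fireable p T≤) (leafNode qleaf _ , refl)
tower≤⇒coverable (suc (suc m)) h p {v} z T≤ =
  Completeness.init-build (suc m) (s≤s z≤n) p (tower≤⇒coverable (suc m) (s≤s z≤n) (<⇒≤ p)) r
    (≤-reflexive (sym 1+r≡T)) (subst (λ w → 2 ^ w ≤ v (d (suc (suc m)) h p)) (sym 1+r≡T) T≤)
    (ZeroBelow-weaken z) (z dₘ ≤-refl) (z d'ₘ ≤-refl) refl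
  where
  open Layer (suc m) (s≤s z≤n) p using (dₘ; d'ₘ)
  r = pred (tower (suc m))
  1+r≡T : suc r ≡ tower (suc m)
  1+r≡T = suc-pred (tower (suc m)) {{m^n≢0 2 (tower m)}}

lemma6p1 : (k : ℕ) (hk : 1 ≤ k) (v₀ : Counter k → ℕ) →
    (∀ i (h : 1 ≤ i) (hi : i < k) → v₀ (d i h (<⇒≤ hi)) ≡ 0 × v₀ (d' i h hi) ≡ 0) →
    (HasCoveringTree (𝓑 k) (qinit k hk ≤-refl) v₀ qleaf ⇔ tower k ≤ v₀ (d k hk ≤-refl))
lemma6p1 k hk v₀ v₀-below =
  mk⇔ (λ c → coverable⇒tower≤ k hk ≤-refl c z) (tower≤⇒coverable k hk ≤-refl z)
  where
  -- The proof of 1 ≤ i inside a counter is irrelevant, so it is rebuilt from i = suc _.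
  z : ZeroBelow k v₀
  z (d  zero    () _)
  z (d' zero    () _)
  z (d  (suc i) _ _) i<k = proj₁ (v₀-below (suc i) (s≤s z≤n) i<k)
  z (d' (suc i) _ _) i<k = proj₂ (v₀-below (suc i) (s≤s z≤n) i<k)
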